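{- Let $G$ be a graph with vertices $v$ and $w$. Let $U$ be the set of common neighbors of $v$ and $w$, $A:=N_G(v)\setminus U$, and $B:=N_G(w)\setminus U$. Suppose that (1) $\mathrm{d}(v,w)=2$, (2) there is no path of length $3$ from $v$ to $w$ in $G$, and (3) $\left(\bigcup_{a\in A}N_G(a)\right)\cap\left(\bigcup_{b\in B}N_G(b)\right)=\emptyset$. If $G':=\mathrm{vid}(G,[v,w])$, then $\mathrm{rank}(\widetilde{H}_1(\mathcal{N}(G')))\leq \mathrm{rank}(\widetilde{H}_1(\mathcal{N}(G)))$.
   Context: Graphs are finite and simple; $N_G(u)$ is the set of neighbors of $u$; $\mathrm{d}$ is graph distance. $\mathrm{vid}(G,[v,w])$ identifies the nonadjacent vertices $v,w$ into one vertex, ignoring multiple edges. The neighborhood complex $\mathcal{N}(G)$ is the simplicial complex on $V(G)$ whose faces are all subsets of the sets $N_G(u)$, $u\in V(G)$. $\widetilde{H}_1$ denotes reduced first simplicial homology. -}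

module Defs where

open import Data.Nat using (ℕ; zero; suc)
open import Data.Fin using (Fin; zero; suc; punchIn; _<_)
open import Data.Integer using (ℤ; _+_; _-_; _*_; 0ℤ)
open import Data.Product using (Σ; _×_; ∃; ∃-syntax; _,_)
open import Data.Sum using (_⊎_)
open import Data.Empty using (⊥)
open import Relation.Nullary using (¬_)
open import Relation.Binary.PropositionalEquality using (_≡_; _≢_)

record Graph (n : ℕ) : Set₁ where
  field
    Adj   : Fin n → Fin n → Set
    sym   : ∀ {x y} → Adj x y → Adj y x
    irrefl : ∀ {x} → ¬ Adj x x
open Graph public

data Walk {n : ℕ} (G : Graph n) : ℕ → Fin n → Fin n → Set where
  here : ∀ {x} → Walk G zero x x
  step : ∀ {k x y z} → Adj G x y → Walk G k y z → Walk G (suc k) x z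

Dist : ∀ {n} → Graph n → Fin n → Fin n → ℕ → Set
Dist G x y k = Walk G k x y × (∀ j → j Data.Nat.< k → ¬ Walk G j x y)

Path3 : ∀ {n} → Graph n → Fin n → Fin n → Set
Path3 G x y = Σ _ λ a → Σ _ λ b →
  (Adj G x a × Adj G a b × Adj G b y) ×
  (x ≢ a × x ≢ b × x ≢ y × a ≢ b × a ≢ y × b ≢ y)

-- Vertex identification vid(G,[v,w]) with w removed.
-- Vertices of vid(G,[v,w]) are Fin m, vertex i standing for
-- punchIn w i of G (w itself is merged into v).

merge : ∀ {m} → Fin (suc m) → Fin (suc m) → Fin (suc m) → Fin (suc m) → Set
merge v w x x' = (x ≡ x') ⊎ (x ≡ w × x' ≡ v)

vid : ∀ {m} → Graph (suc m) → Fin (suc m) → Fin (suc m) → Graph m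
vid {m} G v w = record
  { Adj = A
  ; sym = λ { (ne , x , y , p , q , e) → (λ eq → ne (Relation.Binary.PropositionalEquality.sym eq)) , y , x , q , p , Graph.sym G e }
  ; irrefl = λ { (ne , _) → ne Relation.Binary.PropositionalEquality.refl }
  }
  where
  A : Fin m → Fin m → Set
  A i j = (i ≢ j) × Σ (Fin (suc m)) λ x → Σ (Fin (suc m)) λ y →
            merge v w x (punchIn w i) × merge v w y (punchIn w j) × Adj G x y

-- Neighborhood complex N(G): faces are subsets of some N_G(u).

Face1 : ∀ {n} → Graph n → Fin n → Fin n → Set
Face1 G x y = ∃[ u ] (Adj G u x × Adj G u y)

Face2 : ∀ {n} → Graph n → Fin n → Fin n → Fin n → Set
Face2 G x y z = ∃[ u ] (Adj G u x × Adj G u y × Adj G u z)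

∑ : ∀ {n} → (Fin n → ℤ) → ℤ
∑ {zero} f = 0ℤ
∑ {suc n} f = f zero + ∑ (λ i → f (suc i))

-- A 1-simplex
-- {x,y} is oriented as [x,y] with x < y, a 2-simplex {x,y,z} as
-- [x,y,z] with x < y < z.

Chain1 : ℕ → Set
Chain1 n = Fin n → Fin n → ℤ

Chain2 : ℕ → Set
Chain2 n = Fin n → Fin n → Fin n → ℤ

IsChain1 : ∀ {n} → Graph n → Chain1 n → Set
IsChain1 G c = ∀ x y → c x y ≢ 0ℤ → (x < y) × Face1 G x y

IsChain2 : ∀ {n} → Graph n → Chain2 n → Set
IsChain2 G d = ∀ x y z → d x y z ≢ 0ℤ → (x < y) × (y < z) × Face2 G x y z

-- ∂[x,y] = y - x
∂₁ : ∀ {n} → Chain1 n → Fin n → ℤ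
∂₁ c v = ∑ (λ x → c x v) - ∑ (λ y → c v y)

-- ∂[a,b,c] = [b,c] - [a,c] + [a,b]
∂₂ : ∀ {n} → Chain2 n → Chain1 n
∂₂ d x y = ∑ (λ a → d a x y) - ∑ (λ b → d x b y) + ∑ (λ c → d x y c)

IsCycle1 : ∀ {n} → Graph n → Chain1 n → Set
IsCycle1 G c = IsChain1 G c × (∀ v → ∂₁ c v ≡ 0ℤ)

IsBoundary1 : ∀ {n} → Graph n → Chain1 n → Set
IsBoundary1 G c = ∃[ d ] (IsChain2 G d × (∀ x y → c x y ≡ ∂₂ d x y))

lincomb : ∀ {n k} → (Fin k → ℤ) → (Fin k → Chain1 n) → Chain1 n
lincomb c z x y = ∑ (λ i → c i * z i x y)

-- H̃₁(N(G)) (= H₁, ℤ coefficients) contains k ℤ-linearly independent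
-- elements, i.e. rank H̃₁(N(G)) ≥ k.
IndepH1 : ∀ {n} → Graph n → ℕ → Set
IndepH1 {n} G k = Σ (Fin k → Chain1 n) λ z →
  (∀ i → IsCycle1 G (z i)) ×
  (∀ (c : Fin k → ℤ) → IsBoundary1 G (lincomb c z) → ∀ i → c i ≡ 0ℤ)

{-# OPTIONS --safe #-}
-- Since d(v, w) = 2, the vertices v and w are nonadjacent and have a common neighbour u₀. Being
-- nonadjacent, identifying them is a graph homomorphism p : G → G′, so it induces a simplicial map
-- N(G) → N(G′), and it suffices that this map is surjective on H₁: if independent classes zₜ have
-- preimages Yₜ with p₊Yₜ = zₜ + ∂Eₜ, a relation ∑ cₜ Yₜ = ∂d pushes forward to ∑ cₜ zₜ = ∂(p₊d − ∑ cₜ Eₜ).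
-- Surjectivity is shown edge by edge. An edge {a, b} ⊆ N_{G′}(u′) of N(G′) lifts to a walk of four
-- edges of N(G) whose image is [a, b] plus the boundary of a triangle inside N_{G′}(u′), plus
-- degenerate edges; the walk passes through u₀ when the G-edges realising u′ ~ a and u′ ~ b leave
-- from v and from w respectively. Summing these lifts along a cycle of N(G′) gives a cycle of N(G).

module Submission where

open import Defs hiding (sym)
open import Data.Bool using (if_then_else_)
open import Data.Empty using (⊥-elim)
open import Data.Fin using (Fin; zero; suc; _<_; inject₁; fromℕ; punchIn; punchOut)
open import Data.Fin.Properties
  using (_≟_; _<?_; <-cmp; <-irrefl; <-asym; <-trans; <⇒≢;
         punchIn-punchOut; punchOut-punchIn; punchOut-cong; punchInᵢ≢i)
open import Data.Integer using (ℤ; _+_; _-_; _*_; -_; 0ℤ; 1ℤ)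
import Data.Integer.Properties as ℤ
open import Algebra.Properties.Semiring.Sum ℤ.+-*-semiring
  using (sum; ∑-distrib-+; *-distribˡ-sum) renaming (∑-comm to sum-comm)
open import Data.Integer.Tactic.RingSolver using (solve-∀)
open import Data.Nat using (zero; suc; s≤s; z≤n)
open import Data.Product using (_×_; ∃-syntax; _,_; proj₁; proj₂)
open import Data.Sum using (_⊎_; inj₁; inj₂)
open import Data.Vec.Functional using ([]; _∷_)
open import Function using (_∘_; case_of_)
open import Relation.Binary.Definitions using (tri<; tri≈; tri>)
open import Relation.Binary.PropositionalEquality
open import Relation.Nullary using (¬_; Dec; yes; no; does)

∑≡sum : ∀ {n} (f : Fin n → ℤ) → ∑ f ≡ sum f
∑≡sum {zero}  f = refl
∑≡sum {suc n} f = cong (f zero +_) (∑≡sum (f ∘ suc))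

∑-cong : ∀ {n} {f g : Fin n → ℤ} → (∀ i → f i ≡ g i) → ∑ f ≡ ∑ g
∑-cong {zero}  f≗g = refl
∑-cong {suc n} f≗g = cong₂ _+_ (f≗g zero) (∑-cong (f≗g ∘ suc))

∑-zero : ∀ {n} {f : Fin n → ℤ} → (∀ i → f i ≡ 0ℤ) → ∑ f ≡ 0ℤ
∑-zero {zero}  f≗0 = refl
∑-zero {suc n} f≗0 = cong₂ _+_ (f≗0 zero) (∑-zero (f≗0 ∘ suc))

∑-+ : ∀ {n} (f g : Fin n → ℤ) → ∑ (λ i → f i + g i) ≡ ∑ f + ∑ g
∑-+ f g = trans (∑≡sum (λ i → f i + g i)) (trans (∑-distrib-+ f g) (sym (cong₂ _+_ (∑≡sum f) (∑≡sum g))))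

∑-neg : ∀ {n} (f : Fin n → ℤ) → ∑ (λ i → - f i) ≡ - ∑ f
∑-neg {zero}  f = refl
∑-neg {suc n} f = trans (cong (- f zero +_) (∑-neg (f ∘ suc))) (sym (ℤ.neg-distrib-+ (f zero) _))

∑-- : ∀ {n} (f g : Fin n → ℤ) → ∑ (λ i → f i - g i) ≡ ∑ f - ∑ g
∑-- f g = trans (∑-+ f (λ i → - g i)) (cong (∑ f +_) (∑-neg g))

∑-sub-add : ∀ {n} (f g h : Fin n → ℤ) → ∑ (λ i → f i - g i + h i) ≡ ∑ f - ∑ g + ∑ h
∑-sub-add f g h = trans (∑-+ (λ i → f i - g i) h) (cong (_+ ∑ h) (∑-- f g))

*-distribˡ-∑ : ∀ {n} (k : ℤ) (f : Fin n → ℤ) → k * ∑ f ≡ ∑ (λ i → k * f i)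
*-distribˡ-∑ k f = trans (cong (k *_) (∑≡sum f)) (trans (*-distribˡ-sum k f) (sym (∑≡sum (λ i → k * f i))))

∑-comm : ∀ {n r} (f : Fin n → Fin r → ℤ) → ∑ (λ i → ∑ (f i)) ≡ ∑ (λ j → ∑ (λ i → f i j))
∑-comm f = begin
  ∑ (λ i → ∑ (f i))              ≡⟨ trans (∑-cong (λ i → ∑≡sum (f i))) (∑≡sum (λ i → sum (f i))) ⟩
  sum (λ i → sum (f i))          ≡⟨ sum-comm f ⟩
  sum (λ j → sum (λ i → f i j))  ≡⟨ trans (∑-cong (λ j → ∑≡sum (λ i → f i j))) (∑≡sum (λ j → sum (λ i → f i j))) ⟨
  ∑ (λ j → ∑ (λ i → f i j))      ∎
  where open ≡-Reasoning

∑-telescope : ∀ {r} (g : Fin (suc r) → ℤ) → ∑ (λ t → g (suc t) - g (inject₁ t)) ≡ g (fromℕ r) - g zero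
∑-telescope {zero}  g = sym (ℤ.+-inverseʳ (g zero))
∑-telescope {suc r} g = trans (cong (g (suc zero) - g zero +_) (∑-telescope (g ∘ suc)))
                              (ring (g zero) (g (suc zero)) (g (suc (fromℕ r))))
  where
  ring : ∀ a b c → b - a + (c - b) ≡ c - a
  ring = solve-∀

∑-nonzero : ∀ {n} (f : Fin n → ℤ) → ∑ f ≢ 0ℤ → ∃[ i ] f i ≢ 0ℤ
∑-nonzero {zero}  f ∑f≢0 = ⊥-elim (∑f≢0 refl)
∑-nonzero {suc n} f ∑f≢0 with f zero ℤ.≟ 0ℤ
... | no f₀≢0 = zero , f₀≢0
... | yes f₀≡0 with ∑-nonzero (f ∘ suc) (λ ∑≡0 → ∑f≢0 (cong₂ _+_ f₀≡0 ∑≡0))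
...   | i , fᵢ≢0 = suc i , fᵢ≢0

+≢0⇒ : ∀ a b → a + b ≢ 0ℤ → a ≢ 0ℤ ⊎ b ≢ 0ℤ
+≢0⇒ a b a+b≢0 with a ℤ.≟ 0ℤ
... | no a≢0    = inj₁ a≢0
... | yes refl = inj₂ (λ b≡0 → a+b≢0 (trans (ℤ.+-identityˡ b) b≡0))

-≢0⇒ : ∀ a b → a - b ≢ 0ℤ → a ≢ 0ℤ ⊎ b ≢ 0ℤ
-≢0⇒ a b a-b≢0 with +≢0⇒ a (- b) a-b≢0
... | inj₁ a≢0   = inj₁ a≢0
... | inj₂ -b≢0 = inj₂ (λ b≡0 → -b≢0 (cong -_ b≡0))

*≢0⇒ : ∀ a b → a * b ≢ 0ℤ → a ≢ 0ℤ × b ≢ 0ℤ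
*≢0⇒ a b ab≢0 = (λ a≡0 → ab≢0 (cong (_* b) a≡0)) , (λ b≡0 → ab≢0 (trans (cong (a *_) b≡0) (ℤ.*-zeroʳ a)))

vanishes-off-support : ∀ {P : Set} {a : ℤ} → (a ≢ 0ℤ → P) → ¬ P → a ≡ 0ℤ
vanishes-off-support {a = a} support ¬P with a ℤ.≟ 0ℤ
... | yes a≡0 = a≡0
... | no a≢0  = ⊥-elim (¬P (support a≢0))

*-congʳ-nonzero : ∀ {b c} (a : ℤ) → (a ≢ 0ℤ → b ≡ c) → b * a ≡ c * a
*-congʳ-nonzero {b} {c} a b≡c with a ℤ.≟ 0ℤ
... | yes refl = trans (ℤ.*-zeroʳ b) (sym (ℤ.*-zeroʳ c))
... | no a≢0   = cong (_* a) (b≡c a≢0)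

𝟙 : ∀ {P : Set} → Dec P → ℤ
𝟙 P? = if does P? then 1ℤ else 0ℤ

𝟙-yes : ∀ {P : Set} (P? : Dec P) → P → 𝟙 P? ≡ 1ℤ
𝟙-yes (yes _) _ = refl
𝟙-yes (no ¬p) p = ⊥-elim (¬p p)

𝟙-no : ∀ {P : Set} (P? : Dec P) → ¬ P → 𝟙 P? ≡ 0ℤ
𝟙-no (yes p) ¬p = ⊥-elim (¬p p)
𝟙-no (no _)  _  = refl

𝟙-nonzero : ∀ {P : Set} (P? : Dec P) → 𝟙 P? ≢ 0ℤ → P
𝟙-nonzero (yes p) _   = p
𝟙-nonzero (no _)  1≢0 = ⊥-elim (1≢0 refl)

δ : ∀ {n} → Fin n → Fin n → ℤ
δ a b = 𝟙 (a ≟ b)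

⟦_<_⟧ : ∀ {n} → Fin n → Fin n → ℤ
⟦ a < b ⟧ = 𝟙 (a <? b)

δ-comm : ∀ {n} (a b : Fin n) → δ a b ≡ δ b a
δ-comm a b = case a ≟ b of λ where
  (yes a≡b) → trans (𝟙-yes (a ≟ b) a≡b) (sym (𝟙-yes (b ≟ a) (sym a≡b)))
  (no a≢b)  → trans (𝟙-no (a ≟ b) a≢b) (sym (𝟙-no (b ≟ a) (a≢b ∘ sym)))

∑-δ : ∀ {n} (a : Fin n) (f : Fin n → ℤ) → ∑ (λ x → δ a x * f x) ≡ f a
∑-δ zero    f = trans (cong₂ _+_ (ℤ.*-identityˡ (f zero)) (∑-zero {f = λ x → δ zero (suc x) * f (suc x)} (λ _ → refl)))
                      (ℤ.+-identityʳ (f zero))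
∑-δ (suc a) f = trans (ℤ.+-identityˡ _) (∑-δ a (f ∘ suc))

∑-δʳ : ∀ {n} (a : Fin n) (f : Fin n → ℤ) → ∑ (λ x → f x * δ a x) ≡ f a
∑-δʳ a f = trans (∑-cong (λ x → ℤ.*-comm (f x) (δ a x))) (∑-δ a f)

⟦<⟧-total : ∀ {n} {x y : Fin n} → x ≢ y → ⟦ x < y ⟧ + ⟦ y < x ⟧ ≡ 1ℤ
⟦<⟧-total {x = x} {y} x≢y with <-cmp x y
... | tri< x<y _ y≮x = cong₂ _+_ (𝟙-yes (x <? y) x<y) (𝟙-no (y <? x) y≮x)
... | tri≈ _ x≡y _   = ⊥-elim (x≢y x≡y)
... | tri> x≮y _ y<x = cong₂ _+_ (𝟙-no (x <? y) x≮y) (𝟙-yes (y <? x) y<x)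

⟦<⟧-between : ∀ {n} {t x y : Fin n} → t ≢ x → t ≢ y →
  ⟦ t < x ⟧ * ⟦ x < y ⟧ + ⟦ x < t ⟧ * ⟦ t < y ⟧ + ⟦ x < y ⟧ * ⟦ y < t ⟧ ≡ ⟦ x < y ⟧
⟦<⟧-between {t = t} {x} {y} t≢x t≢y with <-cmp x y | <-cmp t x | <-cmp t y
... | _ | tri≈ _ t≡x _ | _ = ⊥-elim (t≢x t≡x)
... | _ | _ | tri≈ _ t≡y _ = ⊥-elim (t≢y t≡y)
... | tri< x<y _ _ | tri< t<x _ _ | _
  rewrite 𝟙-yes (x <? y) x<y | 𝟙-yes (t <? x) t<x | 𝟙-no (x <? t) (<-asym t<x)
        | 𝟙-no (y <? t) (<-asym (<-trans t<x x<y)) = refl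
... | tri< x<y _ _ | tri> _ _ x<t | _
  rewrite 𝟙-yes (x <? y) x<y | 𝟙-no (t <? x) (<-asym x<t) | 𝟙-yes (x <? t) x<t
  = trans (ring ⟦ t < y ⟧ ⟦ y < t ⟧) (⟦<⟧-total t≢y)
  where ring : ∀ a b → 0ℤ * 1ℤ + 1ℤ * a + 1ℤ * b ≡ a + b
        ring = solve-∀
... | tri≈ _ refl _ | tri< t<x _ _ | _
  rewrite 𝟙-no (x <? x) (<-irrefl refl) | 𝟙-no (x <? t) (<-asym t<x) = ring ⟦ t < x ⟧
  where ring : ∀ a → a * 0ℤ + 0ℤ * a + 0ℤ * 0ℤ ≡ 0ℤ
        ring = solve-∀
... | tri≈ _ refl _ | tri> t≮x _ _ | _
  rewrite 𝟙-no (x <? x) (<-irrefl refl) | 𝟙-no (t <? x) t≮x = ring ⟦ x < t ⟧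
  where ring : ∀ a → 0ℤ * 0ℤ + a * 0ℤ + 0ℤ * a ≡ 0ℤ
        ring = solve-∀
... | tri> x≮y _ _ | _ | tri< t<y _ _
  rewrite 𝟙-no (x <? y) x≮y | 𝟙-no (x <? t) (λ x<t → x≮y (<-trans x<t t<y)) = ring ⟦ t < x ⟧ ⟦ t < y ⟧
  where ring : ∀ a b → a * 0ℤ + 0ℤ * b + 0ℤ * ⟦ y < t ⟧ ≡ 0ℤ
        ring = solve-∀
... | tri> x≮y _ _ | _ | tri> t≮y _ _
  rewrite 𝟙-no (x <? y) x≮y | 𝟙-no (t <? y) t≮y = ring ⟦ t < x ⟧ ⟦ x < t ⟧ ⟦ y < t ⟧
  where ring : ∀ a b c → a * 0ℤ + b * 0ℤ + 0ℤ * c ≡ 0ℤ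
        ring = solve-∀

-- A c : Chain1 n stands for ∑ c x y [x, y] with [y, x] = -[x, y], so its support is arbitrary;
-- orient₁ c is the same chain supported on x < y, the normal form IsChain1 asks for. Likewise a
-- Chain2 stands for a sum of alternating triangles [x, y, z], brought to normal form by orient₂.
skew : ∀ {n} → Chain1 n → Chain1 n
skew c x y = c x y - c y x

orient₁ : ∀ {n} → Chain1 n → Chain1 n
orient₁ c x y = ⟦ x < y ⟧ * skew c x y

alt : ∀ {n} → Chain2 n → Chain2 n
alt d x y z = d x y z - d y x z - d x z y + d y z x + d z x y - d z y x

orient₂ : ∀ {n} → Chain2 n → Chain2 n
orient₂ d x y z = ⟦ x < y ⟧ * ⟦ y < z ⟧ * alt d x y z

edge : ∀ {n} → Fin n → Fin n → Chain1 n
edge a b x y = δ a x * δ b y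

triangle : ∀ {n} → Fin n → Fin n → Fin n → Chain2 n
triangle a b c x y z = δ a x * δ b y * δ c z

walk : ∀ {n r} → (Fin (suc r) → Fin n) → Chain1 n
walk s x y = ∑ (λ t → edge (s (inject₁ t)) (s (suc t)) x y)

Face1-sym : ∀ {n} {G : Graph n} {x y} → Face1 G x y → Face1 G y x
Face1-sym (u , u~x , u~y) = u , u~y , u~x

skew-self : ∀ {n} (c : Chain1 n) x → skew c x x ≡ 0ℤ
skew-self c x = ℤ.+-inverseʳ (c x x)

skew-orient₁ : ∀ {n} (c : Chain1 n) x y → skew (orient₁ c) x y ≡ skew c x y
skew-orient₁ c x y = case x ≟ y of λ where
    (yes refl) → trans (skew-self (orient₁ c) x) (sym (skew-self c x))
    (no x≢y)   → begin
      skew (orient₁ c) x y                     ≡⟨ ring ⟦ x < y ⟧ ⟦ y < x ⟧ (c x y) (c y x) ⟩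
      (⟦ x < y ⟧ + ⟦ y < x ⟧) * skew c x y     ≡⟨ cong (_* skew c x y) (⟦<⟧-total x≢y) ⟩
      1ℤ * skew c x y                          ≡⟨ ℤ.*-identityˡ _ ⟩
      skew c x y                               ∎
  where
  open ≡-Reasoning
  ring : ∀ a b u v → a * (u - v) - b * (v - u) ≡ (a + b) * (u - v)
  ring = solve-∀

skew-degenerate : ∀ {n} {c : Chain1 n} → (∀ x y → c x y ≢ 0ℤ → x ≡ y) → ∀ x y → skew c x y ≡ 0ℤ
skew-degenerate {c = c} diagonal x y = case x ≟ y of λ where
  (yes refl) → skew-self c x
  (no x≢y)   → cong₂ _-_ (vanishes-off-support (diagonal x y) x≢y)
                         (vanishes-off-support (diagonal y x) (x≢y ∘ sym))

∂₁-skew : ∀ {n} (c : Chain1 n) v → ∂₁ c v ≡ ∑ (λ t → skew c t v)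
∂₁-skew c v = sym (∑-- (λ t → c t v) (c v))

∂₁-orient₁ : ∀ {n} (c : Chain1 n) v → ∂₁ (orient₁ c) v ≡ ∂₁ c v
∂₁-orient₁ c v = begin
  ∂₁ (orient₁ c) v               ≡⟨ ∂₁-skew (orient₁ c) v ⟩
  ∑ (λ t → skew (orient₁ c) t v) ≡⟨ ∑-cong (λ t → skew-orient₁ c t v) ⟩
  ∑ (λ t → skew c t v)           ≡⟨ ∂₁-skew c v ⟨
  ∂₁ c v                         ∎
  where open ≡-Reasoning

orient₁-oriented : ∀ {n} {c : Chain1 n} → (∀ x y → c x y ≢ 0ℤ → x < y) → ∀ x y → orient₁ c x y ≡ c x y
orient₁-oriented {c = c} oriented x y = case x <? y of λ where
    (yes x<y) → begin
      orient₁ c x y        ≡⟨ cong₂ (λ a b → a * (c x y - b)) (𝟙-yes (x <? y) x<y)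
                                    (vanishes-off-support (oriented y x) (<-asym x<y)) ⟩
      1ℤ * (c x y - 0ℤ)    ≡⟨ ring (c x y) ⟩
      c x y                ∎
    (no x≮y) → trans (cong (_* skew c x y) (𝟙-no (x <? y) x≮y))
                     (sym (vanishes-off-support (oriented x y) x≮y))
  where
  open ≡-Reasoning
  ring : ∀ a → 1ℤ * (a - 0ℤ) ≡ a
  ring = solve-∀

orient₁-chain : ∀ {n} {G : Graph n} {c : Chain1 n} →
  (∀ x y → c x y ≢ 0ℤ → x ≢ y → Face1 G x y) → IsChain1 G (orient₁ c)
orient₁-chain {G = G} {c = c} face x y o≢0 with *≢0⇒ ⟦ x < y ⟧ (skew c x y) o≢0
... | ⟦x<y⟧≢0 , skew≢0 = x<y , face′ (-≢0⇒ (c x y) (c y x) skew≢0)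
  where
  x<y = 𝟙-nonzero (x <? y) ⟦x<y⟧≢0
  face′ : c x y ≢ 0ℤ ⊎ c y x ≢ 0ℤ → Face1 G x y
  face′ (inj₁ cxy≢0) = face x y cxy≢0 (<⇒≢ x<y)
  face′ (inj₂ cyx≢0) = Face1-sym {G = G} (face y x cyx≢0 (<⇒≢ x<y ∘ sym))

orient₁-lincomb : ∀ {n r} (a : Fin r → ℤ) (F : Fin r → Chain1 n) x y →
  orient₁ (lincomb a F) x y ≡ lincomb a (λ t → orient₁ (F t)) x y
orient₁-lincomb a F x y = begin
  ⟦ x < y ⟧ * (∑ (λ t → a t * F t x y) - ∑ (λ t → a t * F t y x))
    ≡⟨ cong (⟦ x < y ⟧ *_) (∑-- (λ t → a t * F t x y) (λ t → a t * F t y x)) ⟨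
  ⟦ x < y ⟧ * ∑ (λ t → a t * F t x y - a t * F t y x)
    ≡⟨ *-distribˡ-∑ ⟦ x < y ⟧ (λ t → a t * F t x y - a t * F t y x) ⟩
  ∑ (λ t → ⟦ x < y ⟧ * (a t * F t x y - a t * F t y x))
    ≡⟨ ∑-cong (λ t → ring ⟦ x < y ⟧ (a t) (F t x y) (F t y x)) ⟩
  ∑ (λ t → a t * orient₁ (F t) x y) ∎
  where
  open ≡-Reasoning
  ring : ∀ o k u v → o * (k * u - k * v) ≡ k * (o * (u - v))
  ring = solve-∀

∂₁-cong : ∀ {n} {c c′ : Chain1 n} → (∀ x y → c x y ≡ c′ x y) → ∀ v → ∂₁ c v ≡ ∂₁ c′ v
∂₁-cong c≗c′ v = cong₂ _-_ (∑-cong (λ x → c≗c′ x v)) (∑-cong (c≗c′ v))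

∂₁-∑ : ∀ {n r} (F : Fin r → Chain1 n) v → ∂₁ (λ x y → ∑ (λ t → F t x y)) v ≡ ∑ (λ t → ∂₁ (F t) v)
∂₁-∑ F v = trans (cong₂ _-_ (∑-comm (λ x t → F t x v)) (∑-comm (λ y t → F t v y)))
                 (sym (∑-- (λ t → ∑ (λ x → F t x v)) (λ t → ∑ (F t v))))

∂₁-* : ∀ {n} (k : ℤ) (c : Chain1 n) v → ∂₁ (λ x y → k * c x y) v ≡ k * ∂₁ c v
∂₁-* k c v = begin
  ∑ (λ x → k * c x v) - ∑ (λ y → k * c v y)   ≡⟨ cong₂ _-_ (*-distribˡ-∑ k (λ x → c x v)) (*-distribˡ-∑ k (c v)) ⟨
  k * ∑ (λ x → c x v) - k * ∑ (c v)           ≡⟨ ring k _ _ ⟩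
  k * ∂₁ c v                                  ∎
  where
  open ≡-Reasoning
  ring : ∀ k a b → k * a - k * b ≡ k * (a - b)
  ring = solve-∀

∂₁-edge : ∀ {n} (a b : Fin n) v → ∂₁ (edge a b) v ≡ δ b v - δ a v
∂₁-edge a b v = cong₂ _-_ (∑-δ a (λ _ → δ b v)) (∑-δʳ b (λ _ → δ a v))

∂₂-pointwise : ∀ {n} (d : Chain2 n) x y → ∂₂ d x y ≡ ∑ (λ t → d t x y - d x t y + d x y t)
∂₂-pointwise d x y = sym (∑-sub-add (λ t → d t x y) (λ t → d x t y) (d x y))

∂₂-∑ : ∀ {n r} (F : Fin r → Chain2 n) x y →
  ∂₂ (λ a b c → ∑ (λ t → F t a b c)) x y ≡ ∑ (λ t → ∂₂ (F t) x y)
∂₂-∑ F x y = begin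
  ∂₂ (λ a b c → ∑ (λ t → F t a b c)) x y
    ≡⟨ ∂₂-pointwise (λ a b c → ∑ (λ t → F t a b c)) x y ⟩
  ∑ (λ s → ∑ (λ t → F t s x y) - ∑ (λ t → F t x s y) + ∑ (λ t → F t x y s))
    ≡⟨ ∑-cong (λ s → ∑-sub-add (λ t → F t s x y) (λ t → F t x s y) (λ t → F t x y s)) ⟨
  ∑ (λ s → ∑ (λ t → F t s x y - F t x s y + F t x y s))
    ≡⟨ ∑-comm (λ s t → F t s x y - F t x s y + F t x y s) ⟩
  ∑ (λ t → ∑ (λ s → F t s x y - F t x s y + F t x y s))
    ≡⟨ ∑-cong (λ t → ∂₂-pointwise (F t) x y) ⟨
  ∑ (λ t → ∂₂ (F t) x y) ∎
  where open ≡-Reasoning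

∂₂-* : ∀ {n} (k : ℤ) (d : Chain2 n) x y → ∂₂ (λ a b c → k * d a b c) x y ≡ k * ∂₂ d x y
∂₂-* k d x y = begin
  ∂₂ (λ a b c → k * d a b c) x y
    ≡⟨ ∂₂-pointwise (λ a b c → k * d a b c) x y ⟩
  ∑ (λ t → k * d t x y - k * d x t y + k * d x y t)
    ≡⟨ ∑-cong (λ t → ring k (d t x y) (d x t y) (d x y t)) ⟩
  ∑ (λ t → k * (d t x y - d x t y + d x y t))
    ≡⟨ *-distribˡ-∑ k (λ t → d t x y - d x t y + d x y t) ⟨
  k * ∑ (λ t → d t x y - d x t y + d x y t)
    ≡⟨ cong (k *_) (∂₂-pointwise d x y) ⟨
  k * ∂₂ d x y ∎
  where
  open ≡-Reasoning
  ring : ∀ k a b c → k * a - k * b + k * c ≡ k * (a - b + c)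
  ring = solve-∀

∂₂-- : ∀ {n} (d e : Chain2 n) x y → ∂₂ (λ a b c → d a b c - e a b c) x y ≡ ∂₂ d x y - ∂₂ e x y
∂₂-- d e x y = begin
  ∂₂ (λ a b c → d a b c - e a b c) x y
    ≡⟨ ∂₂-pointwise (λ a b c → d a b c - e a b c) x y ⟩
  ∑ (λ t → (d t x y - e t x y) - (d x t y - e x t y) + (d x y t - e x y t))
    ≡⟨ ∑-cong (λ t → ring (d t x y) (e t x y) (d x t y) (e x t y) (d x y t) (e x y t)) ⟩
  ∑ (λ t → (d t x y - d x t y + d x y t) - (e t x y - e x t y + e x y t))
    ≡⟨ ∑-- (λ t → d t x y - d x t y + d x y t) (λ t → e t x y - e x t y + e x y t) ⟩
  ∑ (λ t → d t x y - d x t y + d x y t) - ∑ (λ t → e t x y - e x t y + e x y t)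
    ≡⟨ cong₂ _-_ (∂₂-pointwise d x y) (∂₂-pointwise e x y) ⟨
  ∂₂ d x y - ∂₂ e x y ∎
  where
  open ≡-Reasoning
  ring : ∀ a a′ b b′ c c′ → (a - a′) - (b - b′) + (c - c′) ≡ (a - b + c) - (a′ - b′ + c′)
  ring = solve-∀

∂₂-triangle : ∀ {n} (a b c : Fin n) x y →
  ∂₂ (triangle a b c) x y ≡ edge b c x y - edge a c x y + edge a b x y
∂₂-triangle a b c x y = cong₂ _+_
  (cong₂ _-_ (trans (∑-cong (λ t → ℤ.*-assoc (δ a t) (δ b x) (δ c y))) (∑-δ a (λ _ → δ b x * δ c y)))
             (trans (∑-cong (λ t → ring (δ a x) (δ b t) (δ c y))) (∑-δ b (λ _ → δ a x * δ c y))))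
  (∑-δʳ c (λ _ → δ a x * δ b y))
  where
  ring : ∀ a b c → a * b * c ≡ b * (a * c)
  ring = solve-∀

alt-cycle : ∀ {n} (d : Chain2 n) x y z → alt d x y z ≡ alt d y z x
alt-cycle d x y z = ring (d x y z) (d y x z) (d x z y) (d y z x) (d z x y) (d z y x)
  where
  ring : ∀ a b c e f g → a - b - c + e + f - g ≡ e - g - b + f + a - c
  ring = solve-∀

alt-swap : ∀ {n} (d : Chain2 n) x y z → alt d x y z ≡ - alt d x z y
alt-swap d x y z = ring (d x y z) (d y x z) (d x z y) (d y z x) (d z x y) (d z y x)
  where
  ring : ∀ a b c e f g → a - b - c + e + f - g ≡ - (c - f - a + g + b - e)
  ring = solve-∀

alt-repeat₁₃ : ∀ {n} (d : Chain2 n) x y → alt d x y x ≡ 0ℤ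
alt-repeat₁₃ d x y = ring (d x y x) (d y x x) (d x x y)
  where
  ring : ∀ a b c → a - b - c + b + c - a ≡ 0ℤ
  ring = solve-∀

alt-repeat₂₃ : ∀ {n} (d : Chain2 n) x y → alt d x y y ≡ 0ℤ
alt-repeat₂₃ d x y = ring (d x y y) (d y x y) (d y y x)
  where
  ring : ∀ a b c → a - b - a + c + b - c ≡ 0ℤ
  ring = solve-∀

skew-∂₂ : ∀ {n} (d : Chain2 n) x y → skew (∂₂ d) x y ≡ ∑ (alt d x y)
skew-∂₂ d x y = begin
  ∂₂ d x y - ∂₂ d y x
    ≡⟨ cong₂ _-_ (∂₂-pointwise d x y) (∂₂-pointwise d y x) ⟩
  ∑ (λ t → d t x y - d x t y + d x y t) - ∑ (λ t → d t y x - d y t x + d y x t)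
    ≡⟨ ∑-- (λ t → d t x y - d x t y + d x y t) (λ t → d t y x - d y t x + d y x t) ⟨
  ∑ (λ t → (d t x y - d x t y + d x y t) - (d t y x - d y t x + d y x t))
    ≡⟨ ∑-cong (λ t → ring (d x y t) (d y x t) (d x t y) (d y t x) (d t x y) (d t y x)) ⟩
  ∑ (alt d x y) ∎
  where
  open ≡-Reasoning
  ring : ∀ a b c e f g → (f - c + a) - (g - e + b) ≡ a - b - c + e + f - g
  ring = solve-∀

orient₂-boundary : ∀ {n} (d : Chain2 n) t x y →
  orient₂ d t x y - orient₂ d x t y + orient₂ d x y t ≡ ⟦ x < y ⟧ * alt d x y t
orient₂-boundary d t x y = begin
  ⟦ t < x ⟧ * ⟦ x < y ⟧ * alt d t x y - ⟦ x < t ⟧ * ⟦ t < y ⟧ * alt d x t y + ⟦ x < y ⟧ * ⟦ y < t ⟧ * A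
    ≡⟨ cong₂ (λ B C → ⟦ t < x ⟧ * ⟦ x < y ⟧ * B - ⟦ x < t ⟧ * ⟦ t < y ⟧ * C + ⟦ x < y ⟧ * ⟦ y < t ⟧ * A)
             (alt-cycle d t x y) (alt-swap d x t y) ⟩
  ⟦ t < x ⟧ * ⟦ x < y ⟧ * A - ⟦ x < t ⟧ * ⟦ t < y ⟧ * - A + ⟦ x < y ⟧ * ⟦ y < t ⟧ * A
    ≡⟨ ring ⟦ t < x ⟧ ⟦ x < y ⟧ ⟦ x < t ⟧ ⟦ t < y ⟧ ⟦ y < t ⟧ A ⟩
  (⟦ t < x ⟧ * ⟦ x < y ⟧ + ⟦ x < t ⟧ * ⟦ t < y ⟧ + ⟦ x < y ⟧ * ⟦ y < t ⟧) * A
    ≡⟨ *-congʳ-nonzero A (λ A≢0 → ⟦<⟧-between {t = t} {x} {y} (λ { refl → A≢0 (alt-repeat₁₃ d t y) })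
                                               (λ { refl → A≢0 (alt-repeat₂₃ d x t) })) ⟩
  ⟦ x < y ⟧ * A ∎
  where
  open ≡-Reasoning
  A = alt d x y t
  ring : ∀ a b c e f u → a * b * u - c * e * - u + b * f * u ≡ (a * b + c * e + b * f) * u
  ring = solve-∀

∂₂-orient₂ : ∀ {n} (d : Chain2 n) x y → ∂₂ (orient₂ d) x y ≡ orient₁ (∂₂ d) x y
∂₂-orient₂ d x y = begin
  ∂₂ (orient₂ d) x y                                              ≡⟨ ∂₂-pointwise (orient₂ d) x y ⟩
  ∑ (λ t → orient₂ d t x y - orient₂ d x t y + orient₂ d x y t)   ≡⟨ ∑-cong (λ t → orient₂-boundary d t x y) ⟩
  ∑ (λ t → ⟦ x < y ⟧ * alt d x y t)                               ≡⟨ *-distribˡ-∑ ⟦ x < y ⟧ (alt d x y) ⟨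
  ⟦ x < y ⟧ * ∑ (alt d x y)                                       ≡⟨ cong (⟦ x < y ⟧ *_) (skew-∂₂ d x y) ⟨
  orient₁ (∂₂ d) x y                                              ∎
  where open ≡-Reasoning

alt-face : ∀ {n} {G : Graph n} {d : Chain2 n} → (∀ x y z → d x y z ≢ 0ℤ → Face2 G x y z) →
  ∀ x y z → alt d x y z ≢ 0ℤ → Face2 G x y z
alt-face {d = d} face x y z alt≢0
  with -≢0⇒ (d x y z - d y x z - d x z y + d y z x + d z x y) (d z y x) alt≢0
... | inj₂ ≢0 = let u , u~z , u~y , u~x = face z y x ≢0 in u , u~x , u~y , u~z
... | inj₁ ≢0 with +≢0⇒ (d x y z - d y x z - d x z y + d y z x) (d z x y) ≢0
...   | inj₂ ≢0′ = let u , u~z , u~x , u~y = face z x y ≢0′ in u , u~x , u~y , u~z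
...   | inj₁ ≢0′ with +≢0⇒ (d x y z - d y x z - d x z y) (d y z x) ≢0′
...     | inj₂ ≢0″ = let u , u~y , u~z , u~x = face y z x ≢0″ in u , u~x , u~y , u~z
...     | inj₁ ≢0″ with -≢0⇒ (d x y z - d y x z) (d x z y) ≢0″
...       | inj₂ ≢0‴ = let u , u~x , u~z , u~y = face x z y ≢0‴ in u , u~x , u~y , u~z
...       | inj₁ ≢0‴ with -≢0⇒ (d x y z) (d y x z) ≢0‴
...         | inj₁ dxyz≢0 = face x y z dxyz≢0
...         | inj₂ dyxz≢0 = let u , u~y , u~x , u~z = face y x z dyxz≢0 in u , u~x , u~y , u~z

orient₂-chain : ∀ {n} {G : Graph n} {d : Chain2 n} →
  (∀ x y z → d x y z ≢ 0ℤ → Face2 G x y z) → IsChain2 G (orient₂ d)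
orient₂-chain {G = G} {d = d} face x y z o≢0 with *≢0⇒ (⟦ x < y ⟧ * ⟦ y < z ⟧) (alt d x y z) o≢0
... | ⟦⟧≢0 , alt≢0 with *≢0⇒ ⟦ x < y ⟧ ⟦ y < z ⟧ ⟦⟧≢0
...   | ⟦x<y⟧≢0 , ⟦y<z⟧≢0 =
  𝟙-nonzero (x <? y) ⟦x<y⟧≢0 , 𝟙-nonzero (y <? z) ⟦y<z⟧≢0 , alt-face {G = G} face x y z alt≢0

edge-support : ∀ {n} {a b x y : Fin n} → edge a b x y ≢ 0ℤ → a ≡ x × b ≡ y
edge-support {a = a} {b} {x} {y} e≢0 with *≢0⇒ (δ a x) (δ b y) e≢0
... | δax≢0 , δby≢0 = 𝟙-nonzero (a ≟ x) δax≢0 , 𝟙-nonzero (b ≟ y) δby≢0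

triangle-support : ∀ {n} {a b c x y z : Fin n} → triangle a b c x y z ≢ 0ℤ → a ≡ x × b ≡ y × c ≡ z
triangle-support {a = a} {b} {c} {x} {y} {z} t≢0 with *≢0⇒ (δ a x * δ b y) (δ c z) t≢0
... | ab≢0 , δcz≢0 with edge-support {a = a} {b} {x} {y} ab≢0
...   | a≡x , b≡y = a≡x , b≡y , 𝟙-nonzero (c ≟ z) δcz≢0

chain-decomposition : ∀ {n} (c : Chain1 n) x y → ∑ (λ a → ∑ (λ b → c a b * edge a b x y)) ≡ c x y
chain-decomposition c x y = begin
  ∑ (λ a → ∑ (λ b → c a b * (δ a x * δ b y)))
    ≡⟨ ∑-cong (λ a → ∑-cong (λ b → trans (ring (c a b) (δ a x) (δ b y)) (cong (_* (δ a x * c a b)) (δ-comm b y)))) ⟩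
  ∑ (λ a → ∑ (λ b → δ y b * (δ a x * c a b)))
    ≡⟨ ∑-cong (λ a → ∑-δ y (λ b → δ a x * c a b)) ⟩
  ∑ (λ a → δ a x * c a y)
    ≡⟨ ∑-cong (λ a → cong (_* c a y) (δ-comm a x)) ⟩
  ∑ (λ a → δ x a * c a y)
    ≡⟨ ∑-δ x (λ a → c a y) ⟩
  c x y ∎
  where
  open ≡-Reasoning
  ring : ∀ u a b → u * (a * b) ≡ b * (a * u)
  ring = solve-∀

∂₁-walk : ∀ {n r} (s : Fin (suc r) → Fin n) v → ∂₁ (walk s) v ≡ δ (s (fromℕ r)) v - δ (s zero) v
∂₁-walk s v = begin
  ∂₁ (walk s) v                                        ≡⟨ ∂₁-∑ (λ t → edge (s (inject₁ t)) (s (suc t))) v ⟩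
  ∑ (λ t → ∂₁ (edge (s (inject₁ t)) (s (suc t))) v)    ≡⟨ ∑-cong (λ t → ∂₁-edge (s (inject₁ t)) (s (suc t)) v) ⟩
  ∑ (λ t → δ (s (suc t)) v - δ (s (inject₁ t)) v)      ≡⟨ ∑-telescope (λ i → δ (s i) v) ⟩
  δ (s (fromℕ _)) v - δ (s zero) v                     ∎
  where open ≡-Reasoning

walk-cong : ∀ {n r} {s s′ : Fin (suc r) → Fin n} → (∀ i → s i ≡ s′ i) → ∀ x y → walk s x y ≡ walk s′ x y
walk-cong s≗s′ x y = ∑-cong (λ t → cong₂ (λ a b → edge a b x y) (s≗s′ (inject₁ t)) (s≗s′ (suc t)))

walk-face : ∀ {n r} {G : Graph n} (s : Fin (suc r) → Fin n) →
  (∀ t → s (inject₁ t) ≢ s (suc t) → Face1 G (s (inject₁ t)) (s (suc t))) →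
  ∀ x y → walk s x y ≢ 0ℤ → x ≢ y → Face1 G x y
walk-face s face-step x y walk≢0 x≢y with ∑-nonzero (λ t → edge (s (inject₁ t)) (s (suc t)) x y) walk≢0
... | t , edge≢0 with edge-support {a = s (inject₁ t)} {s (suc t)} edge≢0
...   | refl , refl = face-step t x≢y

-- push₁ p and push₂ p may produce degenerate simplices; orient₁ and orient₂ discard them.
push₀ : ∀ {n m} → (Fin n → Fin m) → (Fin n → ℤ) → Fin m → ℤ
push₀ p f i = ∑ (λ x → δ (p x) i * f x)

push₁ : ∀ {n m} → (Fin n → Fin m) → Chain1 n → Chain1 m
push₁ p c i j = push₀ p (λ x → push₀ p (c x) j) i

push₂ : ∀ {n m} → (Fin n → Fin m) → Chain2 n → Chain2 m
push₂ p d i j k = push₀ p (λ x → push₁ p (d x) j k) i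

module _ {n m} (p : Fin n → Fin m) where

  push₀-cong : ∀ {f g : Fin n → ℤ} → (∀ x → f x ≡ g x) → ∀ i → push₀ p f i ≡ push₀ p g i
  push₀-cong f≗g i = ∑-cong (λ x → cong (δ (p x) i *_) (f≗g x))

  push₀-+ : ∀ (f g : Fin n → ℤ) i → push₀ p (λ x → f x + g x) i ≡ push₀ p f i + push₀ p g i
  push₀-+ f g i = trans (∑-cong (λ x → ℤ.*-distribˡ-+ (δ (p x) i) (f x) (g x)))
                        (∑-+ (λ x → δ (p x) i * f x) (λ x → δ (p x) i * g x))

  push₀-- : ∀ (f g : Fin n → ℤ) i → push₀ p (λ x → f x - g x) i ≡ push₀ p f i - push₀ p g i
  push₀-- f g i = trans (∑-cong (λ x → ring (δ (p x) i) (f x) (g x)))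
                        (∑-- (λ x → δ (p x) i * f x) (λ x → δ (p x) i * g x))
    where
    ring : ∀ a u v → a * (u - v) ≡ a * u - a * v
    ring = solve-∀

  push₀-* : ∀ k (f : Fin n → ℤ) i → push₀ p (λ x → k * f x) i ≡ k * push₀ p f i
  push₀-* k f i = trans (∑-cong (λ x → ring (δ (p x) i) k (f x)))
                        (sym (*-distribˡ-∑ k (λ x → δ (p x) i * f x)))
    where
    ring : ∀ a k u → a * (k * u) ≡ k * (a * u)
    ring = solve-∀

  push₀-∑ : ∀ {r} (F : Fin r → Fin n → ℤ) i → push₀ p (λ x → ∑ (λ t → F t x)) i ≡ ∑ (λ t → push₀ p (F t) i)
  push₀-∑ F i = trans (∑-cong (λ x → *-distribˡ-∑ (δ (p x) i) (λ t → F t x)))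
                      (∑-comm (λ x t → δ (p x) i * F t x))

  push₀-mass : ∀ (f : Fin n → ℤ) → ∑ (push₀ p f) ≡ ∑ f
  push₀-mass f = trans (∑-comm (λ i x → δ (p x) i * f x)) (∑-cong (λ x → ∑-δ (p x) (λ _ → f x)))

  push₀-δ : ∀ a i → push₀ p (δ a) i ≡ δ (p a) i
  push₀-δ a i = trans (∑-cong (λ x → ℤ.*-comm (δ (p x) i) (δ a x))) (∑-δ a (λ x → δ (p x) i))

  push₀-comm : ∀ (F : Fin n → Fin n → ℤ) i j →
    push₀ p (λ x → push₀ p (F x) j) i ≡ push₀ p (λ y → push₀ p (λ x → F x y) i) j
  push₀-comm F i j = begin
    ∑ (λ x → δ (p x) i * ∑ (λ y → δ (p y) j * F x y))
      ≡⟨ ∑-cong (λ x → *-distribˡ-∑ (δ (p x) i) (λ y → δ (p y) j * F x y)) ⟩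
    ∑ (λ x → ∑ (λ y → δ (p x) i * (δ (p y) j * F x y)))
      ≡⟨ ∑-comm (λ x y → δ (p x) i * (δ (p y) j * F x y)) ⟩
    ∑ (λ y → ∑ (λ x → δ (p x) i * (δ (p y) j * F x y)))
      ≡⟨ ∑-cong (λ y → ∑-cong (λ x → ring (δ (p x) i) (δ (p y) j) (F x y))) ⟩
    ∑ (λ y → ∑ (λ x → δ (p y) j * (δ (p x) i * F x y)))
      ≡⟨ ∑-cong (λ y → *-distribˡ-∑ (δ (p y) j) (λ x → δ (p x) i * F x y)) ⟨
    ∑ (λ y → δ (p y) j * ∑ (λ x → δ (p x) i * F x y)) ∎
    where
    open ≡-Reasoning
    ring : ∀ a b u → a * (b * u) ≡ b * (a * u)
    ring = solve-∀

  push₀-support : ∀ (f : Fin n → ℤ) i → push₀ p f i ≢ 0ℤ → ∃[ x ] p x ≡ i × f x ≢ 0ℤ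
  push₀-support f i push≢0 with ∑-nonzero (λ x → δ (p x) i * f x) push≢0
  ... | x , term≢0 with *≢0⇒ (δ (p x) i) (f x) term≢0
  ...   | δ≢0 , fx≢0 = x , 𝟙-nonzero (p x ≟ i) δ≢0 , fx≢0

  push₁-cong : ∀ {c c′ : Chain1 n} → (∀ x y → c x y ≡ c′ x y) → ∀ i j → push₁ p c i j ≡ push₁ p c′ i j
  push₁-cong c≗c′ i j = push₀-cong (λ x → push₀-cong (c≗c′ x) j) i

  push₁-+ : ∀ (c c′ : Chain1 n) i j → push₁ p (λ x y → c x y + c′ x y) i j ≡ push₁ p c i j + push₁ p c′ i j
  push₁-+ c c′ i j = trans (push₀-cong (λ x → push₀-+ (c x) (c′ x) j) i)
                           (push₀-+ (λ x → push₀ p (c x) j) (λ x → push₀ p (c′ x) j) i)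

  push₁-- : ∀ (c c′ : Chain1 n) i j → push₁ p (λ x y → c x y - c′ x y) i j ≡ push₁ p c i j - push₁ p c′ i j
  push₁-- c c′ i j = trans (push₀-cong (λ x → push₀-- (c x) (c′ x) j) i)
                           (push₀-- (λ x → push₀ p (c x) j) (λ x → push₀ p (c′ x) j) i)

  push₁-* : ∀ k (c : Chain1 n) i j → push₁ p (λ x y → k * c x y) i j ≡ k * push₁ p c i j
  push₁-* k c i j = trans (push₀-cong (λ x → push₀-* k (c x) j) i) (push₀-* k (λ x → push₀ p (c x) j) i)

  push₁-∑ : ∀ {r} (F : Fin r → Chain1 n) i j →
    push₁ p (λ x y → ∑ (λ t → F t x y)) i j ≡ ∑ (λ t → push₁ p (F t) i j)
  push₁-∑ F i j = trans (push₀-cong (λ x → push₀-∑ (λ t → F t x) j) i)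
                        (push₀-∑ (λ t x → push₀ p (F t x) j) i)

  push₁-lincomb : ∀ {r} (a : Fin r → ℤ) (F : Fin r → Chain1 n) i j →
    push₁ p (lincomb a F) i j ≡ lincomb a (λ t → push₁ p (F t)) i j
  push₁-lincomb a F i j = trans (push₁-∑ (λ t x y → a t * F t x y) i j) (∑-cong (λ t → push₁-* (a t) (F t) i j))

  push₁-edge : ∀ a b i j → push₁ p (edge a b) i j ≡ edge (p a) (p b) i j
  push₁-edge a b i j = begin
    push₀ p (λ x → push₀ p (λ y → δ a x * δ b y) j) i    ≡⟨ push₀-cong (λ x → push₀-* (δ a x) (δ b) j) i ⟩
    push₀ p (λ x → δ a x * push₀ p (δ b) j) i            ≡⟨ push₀-cong (λ x → cong (δ a x *_) (push₀-δ b j)) i ⟩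
    ∑ (λ x → δ (p x) i * (δ a x * δ (p b) j))            ≡⟨ ∑-cong (λ x → ring (δ (p x) i) (δ a x) (δ (p b) j)) ⟩
    ∑ (λ x → δ a x * (δ (p x) i * δ (p b) j))            ≡⟨ ∑-δ a (λ x → δ (p x) i * δ (p b) j) ⟩
    edge (p a) (p b) i j                                 ∎
    where
    open ≡-Reasoning
    ring : ∀ a b u → a * (b * u) ≡ b * (a * u)
    ring = solve-∀

  skew-push₁ : ∀ (c : Chain1 n) i j → skew (push₁ p c) i j ≡ push₁ p (skew c) i j
  skew-push₁ c i j = trans (cong (_-_ (push₁ p c i j)) (sym (push₀-comm (λ x y → c y x) i j)))
                           (sym (push₁-- c (λ x y → c y x) i j))

  ∂₂-push₂ : ∀ (d : Chain2 n) i j → ∂₂ (push₂ p d) i j ≡ push₁ p (∂₂ d) i j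
  ∂₂-push₂ d i j = begin
    ∂₂ (push₂ p d) i j
      ≡⟨ cong₂ _+_ (cong₂ _-_ first middle) last ⟩
    push₁ p (λ y z → ∑ (λ x → d x y z)) i j - push₁ p (λ x z → ∑ (λ y → d x y z)) i j
      + push₁ p (λ x y → ∑ (d x y)) i j
      ≡⟨ trans (push₁-+ (λ x y → ∑ (λ t → d t x y) - ∑ (λ t → d x t y)) (λ x y → ∑ (d x y)) i j)
               (cong (_+ push₁ p (λ x y → ∑ (d x y)) i j)
                     (push₁-- (λ x y → ∑ (λ t → d t x y)) (λ x y → ∑ (λ t → d x t y)) i j)) ⟨
    push₁ p (∂₂ d) i j ∎
    where
    open ≡-Reasoning
    first : ∑ (λ a → push₂ p d a i j) ≡ push₁ p (λ y z → ∑ (λ x → d x y z)) i j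
    first = trans (push₀-mass (λ x → push₁ p (d x) i j)) (sym (push₁-∑ d i j))
    middle : ∑ (λ b → push₂ p d i b j) ≡ push₁ p (λ x z → ∑ (λ y → d x y z)) i j
    middle = trans (sym (push₀-∑ (λ b x → push₁ p (d x) b j) i))
                   (push₀-cong (λ x → trans (push₀-mass (λ y → push₀ p (d x y) j))
                                            (sym (push₀-∑ (d x) j))) i)
    last : ∑ (λ c → push₂ p d i j c) ≡ push₁ p (λ x y → ∑ (d x y)) i j
    last = trans (sym (push₀-∑ (λ c x → push₀ p (λ y → push₀ p (d x y) c) j) i))
                 (push₀-cong (λ x → trans (sym (push₀-∑ (λ c y → push₀ p (d x y) c) j))
                                          (push₀-cong (λ y → push₀-mass (d x y)) j)) i)

  push₂-support : ∀ (d : Chain2 n) i j k → push₂ p d i j k ≢ 0ℤ →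
    ∃[ x ] ∃[ y ] ∃[ z ] p x ≡ i × p y ≡ j × p z ≡ k × d x y z ≢ 0ℤ
  push₂-support d i j k push≢0 with push₀-support (λ x → push₁ p (d x) j k) i push≢0
  ... | x , refl , ≢0 with push₀-support (λ y → push₀ p (d x y) k) j ≢0
  ...   | y , refl , ≢0′ with push₀-support (d x y) k ≢0′
  ...     | z , refl , dxyz≢0 = x , y , z , refl , refl , refl , dxyz≢0

  skew-push₁-orient₁ : ∀ (c : Chain1 n) i j → skew (push₁ p (orient₁ c)) i j ≡ skew (push₁ p c) i j
  skew-push₁-orient₁ c i j = trans (skew-push₁ (orient₁ c) i j)
                                   (trans (push₁-cong (skew-orient₁ c) i j) (sym (skew-push₁ c i j)))

  push₁-walk : ∀ {r} (s : Fin (suc r) → Fin n) i j → push₁ p (walk s) i j ≡ walk (p ∘ s) i j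
  push₁-walk s i j = trans (push₁-∑ (λ t → edge (s (inject₁ t)) (s (suc t))) i j)
                           (∑-cong (λ t → push₁-edge (s (inject₁ t)) (s (suc t)) i j))

record HomologyPreimage {n m} (G : Graph n) (H : Graph m) (p : Fin n → Fin m) (z : Chain1 m) : Set where
  field
    cycle       : Chain1 n
    filler      : Chain2 m
    is-cycle    : IsCycle1 G cycle
    filler-face : ∀ x y w → filler x y w ≢ 0ℤ → Face2 H x y w
    push-cycle  : ∀ i j → orient₁ (λ x y → push₁ p cycle x y - ∂₂ filler x y) i j ≡ z i j

open HomologyPreimage

module _ {n m} {G : Graph n} {H : Graph m} (p : Fin n → Fin m)
         (face-map : ∀ {x y z} → Face2 G x y z → Face2 H (p x) (p y) (p z)) where

  push-boundary : ∀ {k} {z : Fin k → Chain1 m} (Z : ∀ t → HomologyPreimage G H p (z t)) (c : Fin k → ℤ) →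
    IsBoundary1 G (lincomb c (cycle ∘ Z)) → IsBoundary1 H (lincomb c z)
  push-boundary {k} {z} Z c (d , d-chain , Yc≡∂d) =
    orient₂ Φ , orient₂-chain {G = H} Φ-face , λ i j → sym (∂orient₂Φ i j)
    where
    image : Fin k → Chain1 m
    image t x y = push₁ p (cycle (Z t)) x y - ∂₂ (filler (Z t)) x y

    Φ : Chain2 m
    Φ x y w = push₂ p d x y w - ∑ (λ t → c t * filler (Z t) x y w)

    Φ-face : ∀ x y w → Φ x y w ≢ 0ℤ → Face2 H x y w
    Φ-face x y w Φ≢0 with -≢0⇒ (push₂ p d x y w) (∑ (λ t → c t * filler (Z t) x y w)) Φ≢0
    ... | inj₁ push≢0 with push₂-support p d x y w push≢0
    ...   | a , b , e , refl , refl , refl , d≢0 = face-map (proj₂ (proj₂ (d-chain a b e d≢0)))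
    Φ-face x y w Φ≢0 | inj₂ ∑≢0 with ∑-nonzero (λ t → c t * filler (Z t) x y w) ∑≢0
    ... | t , ≢0 = filler-face (Z t) x y w (proj₂ (*≢0⇒ (c t) (filler (Z t) x y w) ≢0))

    ∂Φ : ∀ x y → ∂₂ Φ x y ≡ lincomb c image x y
    ∂Φ x y = begin
      ∂₂ Φ x y
        ≡⟨ ∂₂-- (push₂ p d) (λ a b e → ∑ (λ t → c t * filler (Z t) a b e)) x y ⟩
      ∂₂ (push₂ p d) x y - ∂₂ (λ a b e → ∑ (λ t → c t * filler (Z t) a b e)) x y
        ≡⟨ cong₂ _-_ (∂₂-push₂ p d x y)
                     (trans (∂₂-∑ (λ t a b e → c t * filler (Z t) a b e) x y)
                            (∑-cong (λ t → ∂₂-* (c t) (filler (Z t)) x y))) ⟩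
      push₁ p (∂₂ d) x y - ∑ (λ t → c t * ∂₂ (filler (Z t)) x y)
        ≡⟨ cong (_- ∑ (λ t → c t * ∂₂ (filler (Z t)) x y))
                (trans (push₁-cong p (λ a b → sym (Yc≡∂d a b)) x y) (push₁-lincomb p c (cycle ∘ Z) x y)) ⟩
      ∑ (λ t → c t * push₁ p (cycle (Z t)) x y) - ∑ (λ t → c t * ∂₂ (filler (Z t)) x y)
        ≡⟨ ∑-- (λ t → c t * push₁ p (cycle (Z t)) x y) (λ t → c t * ∂₂ (filler (Z t)) x y) ⟨
      ∑ (λ t → c t * push₁ p (cycle (Z t)) x y - c t * ∂₂ (filler (Z t)) x y)
        ≡⟨ ∑-cong (λ t → ring (c t) (push₁ p (cycle (Z t)) x y) (∂₂ (filler (Z t)) x y)) ⟩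
      lincomb c image x y ∎
      where
      open ≡-Reasoning
      ring : ∀ k u v → k * u - k * v ≡ k * (u - v)
      ring = solve-∀

    ∂orient₂Φ : ∀ i j → ∂₂ (orient₂ Φ) i j ≡ lincomb c z i j
    ∂orient₂Φ i j = begin
      ∂₂ (orient₂ Φ) i j
        ≡⟨ ∂₂-orient₂ Φ i j ⟩
      orient₁ (∂₂ Φ) i j
        ≡⟨ cong (⟦ i < j ⟧ *_) (cong₂ _-_ (∂Φ i j) (∂Φ j i)) ⟩
      orient₁ (lincomb c image) i j
        ≡⟨ orient₁-lincomb c image i j ⟩
      ∑ (λ t → c t * orient₁ (image t) i j)
        ≡⟨ ∑-cong (λ t → cong (c t *_) (push-cycle (Z t) i j)) ⟩
      lincomb c z i j ∎
      where open ≡-Reasoning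

  IndepH1-reflect : (∀ z → IsCycle1 H z → HomologyPreimage G H p z) → ∀ k → IndepH1 H k → IndepH1 G k
  IndepH1-reflect preimage k (z , z-cycle , z-independent) =
    cycle ∘ Z , is-cycle ∘ Z , λ c → z-independent c ∘ push-boundary Z c
    where
    Z : ∀ t → HomologyPreimage G H p (z t)
    Z t = preimage (z t) (z-cycle t)

module Identification {m} (G : Graph (suc m)) {v w : Fin (suc m)} (v≢w : v ≢ w) (v≁w : ¬ Adj G v w) where

  G′ : Graph m
  G′ = vid G v w

  collapse : Fin (suc m) → Fin m
  collapse x with w ≟ x
  ... | yes _   = punchOut (v≢w ∘ sym)
  ... | no w≢x  = punchOut w≢x

  collapse-merge : ∀ x → merge v w x (punchIn w (collapse x))
  collapse-merge x with w ≟ x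
  ... | yes refl = inj₂ (refl , punchIn-punchOut (v≢w ∘ sym))
  ... | no w≢x   = inj₁ (sym (punchIn-punchOut w≢x))

  collapse-punchIn : ∀ i → collapse (punchIn w i) ≡ i
  collapse-punchIn i with w ≟ punchIn w i
  ... | yes w≡i′ = ⊥-elim (punchInᵢ≢i w i (sym w≡i′))
  ... | no _     = trans (punchOut-cong w refl) (punchOut-punchIn w)

  collapse-w : collapse w ≡ collapse v
  collapse-w with w ≟ w | w ≟ v
  ... | no w≢w | _       = ⊥-elim (w≢w refl)
  ... | yes _  | yes w≡v = ⊥-elim (v≢w (sym w≡v))
  ... | yes _  | no _    = punchOut-cong w refl

  merge⇒collapse : ∀ {x a} → merge v w x (punchIn w a) → collapse x ≡ a
  merge⇒collapse {a = a} (inj₁ refl)        = collapse-punchIn a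
  merge⇒collapse {a = a} (inj₂ (refl , a′≡v)) =
    trans collapse-w (trans (cong collapse (sym a′≡v)) (collapse-punchIn a))

  collapse-adj : ∀ {x y} → Adj G x y → Adj G′ (collapse x) (collapse y)
  collapse-adj {x} {y} x~y = collapse≢ , x , y , collapse-merge x , collapse-merge y , x~y
    where
    collapse≢ : collapse x ≢ collapse y
    collapse≢ cx≡cy with collapse-merge x | collapse-merge y
    ... | inj₁ x≡ | inj₁ y≡ =
      Graph.irrefl G (subst (Adj G x) (sym (trans x≡ (trans (cong (punchIn w) cx≡cy) (sym y≡)))) x~y)
    ... | inj₁ x≡ | inj₂ (refl , ≡v) =
      v≁w (subst (λ z → Adj G z w) (trans x≡ (trans (cong (punchIn w) cx≡cy) ≡v)) x~y)
    ... | inj₂ (refl , ≡v) | inj₁ y≡ =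
      v≁w (Graph.sym G (subst (Adj G w) (trans y≡ (trans (cong (punchIn w) (sym cx≡cy)) ≡v)) x~y))
    ... | inj₂ (refl , _) | inj₂ (refl , _) = Graph.irrefl G x~y

  collapse-face : ∀ {x y z} → Face2 G x y z → Face2 G′ (collapse x) (collapse y) (collapse z)
  collapse-face (u , u~x , u~y , u~z) = collapse u , collapse-adj u~x , collapse-adj u~y , collapse-adj u~z

  module _ {u₀ : Fin (suc m)} (v~u₀ : Adj G v u₀) (w~u₀ : Adj G w u₀) where

    merge-face : ∀ {x x′} → merge v w x x′ → x′ ≢ x → Face1 G x′ x
    merge-face (inj₁ refl)         x′≢x = ⊥-elim (x′≢x refl)
    merge-face (inj₂ (refl , refl)) _   = u₀ , Graph.sym G v~u₀ , Graph.sym G w~u₀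

    merge-collision : ∀ {x y t} → merge v w x t → merge v w y t → x ≢ y → t ≡ v
    merge-collision (inj₁ refl)      (inj₁ refl)      x≢y = ⊥-elim (x≢y refl)
    merge-collision (inj₁ _)         (inj₂ (_ , t≡v)) _   = t≡v
    merge-collision (inj₂ (_ , t≡v)) _                _   = t≡v

    merge-neighbour : ∀ {x} → merge v w x v → Adj G x u₀
    merge-neighbour (inj₁ refl)       = v~u₀
    merge-neighbour (inj₂ (refl , _)) = w~u₀

    record ChainLift (c : Chain1 m) : Set where
      field
        chain               : Chain1 (suc m)
        filler              : Chain2 m
        degenerate          : Chain1 m
        chain-face          : ∀ x y → chain x y ≢ 0ℤ → x ≢ y → Face1 G x y
        filler-face         : ∀ x y z → filler x y z ≢ 0ℤ → Face2 G′ x y z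
        degenerate-diagonal : ∀ x y → degenerate x y ≢ 0ℤ → x ≡ y
        ∂-chain             : ∀ x → ∂₁ chain x ≡ push₀ (punchIn w) (∂₁ c) x
        push-chain          : ∀ i j → push₁ collapse chain i j ≡ c i j + ∂₂ filler i j + degenerate i j

    open ChainLift

    ChainLift-∑ : ∀ {r} (F : Fin r → Chain1 m) → (∀ t → ChainLift (F t)) → ChainLift (λ x y → ∑ (λ t → F t x y))
    ChainLift-∑ F L = record
      { chain               = λ x y → ∑ (λ t → chain (L t) x y)
      ; filler              = λ x y z → ∑ (λ t → filler (L t) x y z)
      ; degenerate          = λ x y → ∑ (λ t → degenerate (L t) x y)
      ; chain-face          = λ x y ≢0 →
          let t , ≢0′ = ∑-nonzero (λ t → chain (L t) x y) ≢0
          in chain-face (L t) x y ≢0′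
      ; filler-face         = λ x y z ≢0 →
          let t , ≢0′ = ∑-nonzero (λ t → filler (L t) x y z) ≢0
          in filler-face (L t) x y z ≢0′
      ; degenerate-diagonal = λ x y ≢0 →
          let t , ≢0′ = ∑-nonzero (λ t → degenerate (L t) x y) ≢0
          in degenerate-diagonal (L t) x y ≢0′
      ; ∂-chain             = ∂-∑
      ; push-chain          = push-∑
      }
      where
      open ≡-Reasoning
      ∂-∑ : ∀ x → ∂₁ (λ x y → ∑ (λ t → chain (L t) x y)) x ≡ push₀ (punchIn w) (∂₁ (λ x y → ∑ (λ t → F t x y))) x
      ∂-∑ x = begin
        ∂₁ (λ x y → ∑ (λ t → chain (L t) x y)) x            ≡⟨ ∂₁-∑ (chain ∘ L) x ⟩
        ∑ (λ t → ∂₁ (chain (L t)) x)                         ≡⟨ ∑-cong (λ t → ∂-chain (L t) x) ⟩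
        ∑ (λ t → push₀ (punchIn w) (∂₁ (F t)) x)             ≡⟨ push₀-∑ (punchIn w) (λ t → ∂₁ (F t)) x ⟨
        push₀ (punchIn w) (λ s → ∑ (λ t → ∂₁ (F t) s)) x     ≡⟨ push₀-cong (punchIn w) (∂₁-∑ F) x ⟨
        push₀ (punchIn w) (∂₁ (λ x y → ∑ (λ t → F t x y))) x ∎
      push-∑ : ∀ i j → push₁ collapse (λ x y → ∑ (λ t → chain (L t) x y)) i j
                       ≡ ∑ (λ t → F t i j) + ∂₂ (λ x y z → ∑ (λ t → filler (L t) x y z)) i j
                         + ∑ (λ t → degenerate (L t) i j)
      push-∑ i j = begin
        push₁ collapse (λ x y → ∑ (λ t → chain (L t) x y)) i j
          ≡⟨ push₁-∑ collapse (chain ∘ L) i j ⟩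
        ∑ (λ t → push₁ collapse (chain (L t)) i j)
          ≡⟨ ∑-cong (λ t → push-chain (L t) i j) ⟩
        ∑ (λ t → F t i j + ∂₂ (filler (L t)) i j + degenerate (L t) i j)
          ≡⟨ trans (∑-+ (λ t → F t i j + ∂₂ (filler (L t)) i j) (λ t → degenerate (L t) i j))
                   (cong (_+ ∑ (λ t → degenerate (L t) i j)) (∑-+ (λ t → F t i j) (λ t → ∂₂ (filler (L t)) i j))) ⟩
        ∑ (λ t → F t i j) + ∑ (λ t → ∂₂ (filler (L t)) i j) + ∑ (λ t → degenerate (L t) i j)
          ≡⟨ cong (λ e → ∑ (λ t → F t i j) + e + ∑ (λ t → degenerate (L t) i j)) (∂₂-∑ (filler ∘ L) i j) ⟨
        ∑ (λ t → F t i j) + ∂₂ (λ x y z → ∑ (λ t → filler (L t) x y z)) i j + ∑ (λ t → degenerate (L t) i j) ∎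

    ChainLift-zero : ChainLift (λ _ _ → 0ℤ)
    ChainLift-zero = ChainLift-∑ {r = 0} (λ ()) (λ ())

    ChainLift-cong : ∀ {c c′} → (∀ x y → c x y ≡ c′ x y) → ChainLift c → ChainLift c′
    ChainLift-cong c≗c′ L = record
      { chain               = chain L
      ; filler              = filler L
      ; degenerate          = degenerate L
      ; chain-face          = chain-face L
      ; filler-face         = filler-face L
      ; degenerate-diagonal = degenerate-diagonal L
      ; ∂-chain             = λ x → trans (∂-chain L x) (push₀-cong (punchIn w) (∂₁-cong c≗c′) x)
      ; push-chain          = λ i j → trans (push-chain L i j)
                                            (cong (λ e → e + ∂₂ (filler L) i j + degenerate L i j) (c≗c′ i j))
      }

    -- The walk punchIn w a, s₁, s₂, s₃, punchIn w b collapses to a, a, M, b, b, that is to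
    -- [a, b] + ∂[a, M, b] + [a, a] + [b, b].
    walkLift : ∀ k a b {s₁ s₂ s₃} → merge v w s₁ (punchIn w a) → merge v w s₃ (punchIn w b) →
      (s₁ ≢ s₂ → Face1 G s₁ s₂) → (s₂ ≢ s₃ → Face1 G s₂ s₃) → Face2 G′ a (collapse s₂) b →
      ChainLift (λ x y → k * edge a b x y)
    walkLift k a b {s₁} {s₂} {s₃} s₁↦a s₃↦b face₁₂ face₂₃ triangle-face = record
      { chain               = λ x y → k * walk path x y
      ; filler              = λ x y z → k * triangle a M b x y z
      ; degenerate          = λ x y → k * (edge a a x y + edge b b x y)
      ; chain-face          = λ x y ≢0 → walk-face {G = G} path path-face x y (proj₂ (*≢0⇒ k (walk path x y) ≢0))
      ; filler-face         = filler-face′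
      ; degenerate-diagonal = degenerate-diagonal′
      ; ∂-chain             = ∂-walk
      ; push-chain          = push-walk
      }
      where
      open ≡-Reasoning
      M = collapse s₂

      path : Fin 5 → Fin (suc m)
      path = punchIn w a ∷ s₁ ∷ s₂ ∷ s₃ ∷ punchIn w b ∷ []

      path-face : ∀ t → path (inject₁ t) ≢ path (suc t) → Face1 G (path (inject₁ t)) (path (suc t))
      path-face zero                   = merge-face s₁↦a
      path-face (suc zero)             = face₁₂
      path-face (suc (suc zero))       = face₂₃
      path-face (suc (suc (suc zero))) = λ s₃≢b′ → Face1-sym {G = G} (merge-face s₃↦b (s₃≢b′ ∘ sym))

      collapse-path : ∀ t → collapse (path t) ≡ (a ∷ a ∷ M ∷ b ∷ b ∷ []) t
      collapse-path zero                         = collapse-punchIn a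
      collapse-path (suc zero)                   = merge⇒collapse s₁↦a
      collapse-path (suc (suc zero))             = refl
      collapse-path (suc (suc (suc zero)))       = merge⇒collapse s₃↦b
      collapse-path (suc (suc (suc (suc zero)))) = collapse-punchIn b

      filler-face′ : ∀ x y z → k * triangle a M b x y z ≢ 0ℤ → Face2 G′ x y z
      filler-face′ x y z ≢0
        with triangle-support {a = a} {M} {b} {x} {y} {z} (proj₂ (*≢0⇒ k (triangle a M b x y z) ≢0))
      ... | refl , refl , refl = triangle-face

      degenerate-diagonal′ : ∀ x y → k * (edge a a x y + edge b b x y) ≢ 0ℤ → x ≡ y
      degenerate-diagonal′ x y ≢0 with +≢0⇒ (edge a a x y) (edge b b x y) (proj₂ (*≢0⇒ k _ ≢0))
      ... | inj₁ ≢0′ = let a≡x , a≡y = edge-support {a = a} {a} {x} {y} ≢0′ in trans (sym a≡x) a≡y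
      ... | inj₂ ≢0′ = let b≡x , b≡y = edge-support {a = b} {b} {x} {y} ≢0′ in trans (sym b≡x) b≡y

      ∂-walk : ∀ x → ∂₁ (λ x y → k * walk path x y) x ≡ push₀ (punchIn w) (∂₁ (λ x y → k * edge a b x y)) x
      ∂-walk x = begin
        ∂₁ (λ x y → k * walk path x y) x
          ≡⟨ trans (∂₁-* k (walk path) x) (cong (k *_) (∂₁-walk path x)) ⟩
        k * (δ (punchIn w b) x - δ (punchIn w a) x)
          ≡⟨ cong (k *_) (cong₂ _-_ (push₀-δ (punchIn w) b x) (push₀-δ (punchIn w) a x)) ⟨
        k * (push₀ (punchIn w) (δ b) x - push₀ (punchIn w) (δ a) x)
          ≡⟨ cong (k *_) (push₀-- (punchIn w) (δ b) (δ a) x) ⟨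
        k * push₀ (punchIn w) (λ s → δ b s - δ a s) x
          ≡⟨ push₀-* (punchIn w) k (λ s → δ b s - δ a s) x ⟨
        push₀ (punchIn w) (λ s → k * (δ b s - δ a s)) x
          ≡⟨ push₀-cong (punchIn w) (λ s → trans (∂₁-* k (edge a b) s) (cong (k *_) (∂₁-edge a b s))) x ⟨
        push₀ (punchIn w) (∂₁ (λ x y → k * edge a b x y)) x ∎

      push-walk : ∀ i j → push₁ collapse (λ x y → k * walk path x y) i j
                          ≡ k * edge a b i j + ∂₂ (λ x y z → k * triangle a M b x y z) i j
                            + k * (edge a a i j + edge b b i j)
      push-walk i j = begin
        push₁ collapse (λ x y → k * walk path x y) i j
          ≡⟨ trans (push₁-* collapse k (walk path) i j) (cong (k *_) (push₁-walk collapse path i j)) ⟩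
        k * walk (collapse ∘ path) i j
          ≡⟨ cong (k *_) (walk-cong collapse-path i j) ⟩
        k * (edge a a i j + (edge a M i j + (edge M b i j + (edge b b i j + 0ℤ))))
          ≡⟨ ring k (edge a a i j) (edge a M i j) (edge M b i j) (edge b b i j) (edge a b i j) ⟩
        k * edge a b i j + k * (edge M b i j - edge a b i j + edge a M i j) + k * (edge a a i j + edge b b i j)
          ≡⟨ cong (λ e → k * edge a b i j + e + k * (edge a a i j + edge b b i j))
                  (trans (∂₂-* k (triangle a M b) i j) (cong (k *_) (∂₂-triangle a M b i j))) ⟨
        k * edge a b i j + ∂₂ (λ x y z → k * triangle a M b x y z) i j + k * (edge a a i j + edge b b i j) ∎
        where
        ring : ∀ k aa aM Mb bb ab → k * (aa + (aM + (Mb + (bb + 0ℤ)))) ≡ k * ab + k * (Mb - ab + aM) + k * (aa + bb)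
        ring = solve-∀

    -- The adjacencies u′ ~ a and u′ ~ b of G′ come from edges x₁ ~ y₁ and x₂ ~ y₂ of G with x₁, x₂ ↦ u′.
    -- Either x₁ = x₂ is a common neighbour of y₁ and y₂, or {x₁, x₂} = {v, w} and u₀ links y₁ to y₂.
    edgeLift : ∀ k a b → Face1 G′ a b → ChainLift (λ x y → k * edge a b x y)
    edgeLift k a b (u′ , u′~a@(_ , x₁ , y₁ , x₁↦u′ , y₁↦a , x₁~y₁) , u′~b@(_ , x₂ , y₂ , x₂↦u′ , y₂↦b , x₂~y₂))
      with x₁ ≟ x₂
    ... | yes refl = walkLift k a b y₁↦a y₂↦b (λ _ → x₁ , x₁~y₁ , x₂~y₂) (λ y₂≢y₂ → ⊥-elim (y₂≢y₂ refl))
                       (subst (λ M → Face2 G′ a M b) (sym (merge⇒collapse y₂↦b)) (u′ , u′~a , u′~b , u′~b))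
    ... | no x₁≢x₂ = walkLift k a b y₁↦a y₂↦b (λ _ → x₁ , x₁~y₁ , x₁~u₀) (λ _ → x₂ , x₂~u₀ , x₂~y₂)
                       (u′ , u′~a , u′~collapse-u₀ , u′~b)
      where
      u′≡v = merge-collision x₁↦u′ x₂↦u′ x₁≢x₂
      x₁~u₀ = merge-neighbour (subst (merge v w x₁) u′≡v x₁↦u′)
      x₂~u₀ = merge-neighbour (subst (merge v w x₂) u′≡v x₂↦u′)
      u′~collapse-u₀ : Adj G′ u′ (collapse u₀)
      u′~collapse-u₀ = subst (λ u → Adj G′ u (collapse u₀)) (trans (cong collapse (sym u′≡v)) (collapse-punchIn u′))
                             (collapse-adj v~u₀)

    termLift : ∀ k a b → (k ≢ 0ℤ → Face1 G′ a b) → ChainLift (λ x y → k * edge a b x y)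
    termLift k a b face = case k ℤ.≟ 0ℤ of λ where
      (yes refl) → ChainLift-zero
      (no k≢0)   → edgeLift k a b (face k≢0)

    chainLift : ∀ {c} → IsChain1 G′ c → ChainLift c
    chainLift {c} c-chain = ChainLift-cong (chain-decomposition c)
      (ChainLift-∑ _ (λ a → ChainLift-∑ _ (λ b → termLift (c a b) a b (proj₂ ∘ c-chain a b))))

    cycle-preimage : ∀ z → IsCycle1 G′ z → HomologyPreimage G G′ collapse z
    cycle-preimage z (z-chain , ∂z≡0) = record
      { cycle       = orient₁ (chain L)
      ; filler      = filler L
      ; is-cycle    = orient₁-chain {G = G} (chain-face L) , ∂orient₁≡0
      ; filler-face = filler-face L
      ; push-cycle  = λ i j → trans (cong (⟦ i < j ⟧ *_) (skew-push i j))
                                    (orient₁-oriented (λ x y → proj₁ ∘ z-chain x y) i j)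
      }
      where
      open ≡-Reasoning
      L = chainLift z-chain

      ∂orient₁≡0 : ∀ x → ∂₁ (orient₁ (chain L)) x ≡ 0ℤ
      ∂orient₁≡0 x = begin
        ∂₁ (orient₁ (chain L)) x            ≡⟨ trans (∂₁-orient₁ (chain L) x) (∂-chain L x) ⟩
        push₀ (punchIn w) (∂₁ z) x          ≡⟨ push₀-cong (punchIn w) ∂z≡0 x ⟩
        push₀ (punchIn w) (λ _ → 0ℤ) x      ≡⟨ ∑-zero (λ s → ℤ.*-zeroʳ (δ (punchIn w s) x)) ⟩
        0ℤ                                  ∎

      skew-push : ∀ i j → skew (λ x y → push₁ collapse (orient₁ (chain L)) x y - ∂₂ (filler L) x y) i j ≡ skew z i j
      skew-push i j = begin
        skew (λ x y → P x y - E x y) i j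
          ≡⟨ ring (P i j) (P j i) (E i j) (E j i) ⟩
        skew P i j - skew E i j
          ≡⟨ cong (_- skew E i j) (skew-push₁-orient₁ collapse (chain L) i j) ⟩
        skew (push₁ collapse (chain L)) i j - skew E i j
          ≡⟨ cong (_- skew E i j) (cong₂ _-_ (push-chain L i j) (push-chain L j i)) ⟩
        (z i j + E i j + D i j) - (z j i + E j i + D j i) - skew E i j
          ≡⟨ ring′ (z i j) (z j i) (E i j) (E j i) (D i j) (D j i) ⟩
        skew z i j + skew D i j
          ≡⟨ cong (skew z i j +_) (skew-degenerate (degenerate-diagonal L) i j) ⟩
        skew z i j + 0ℤ
          ≡⟨ ℤ.+-identityʳ _ ⟩
        skew z i j ∎
        where
        P = push₁ collapse (orient₁ (chain L))
        E = ∂₂ (filler L)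
        D = degenerate L
        ring : ∀ p p′ e e′ → (p - e) - (p′ - e′) ≡ (p - p′) - (e - e′)
        ring = solve-∀
        ring′ : ∀ a a′ e e′ d d′ → (a + e + d) - (a′ + e′ + d′) - (e - e′) ≡ (a - a′) + (d - d′)
        ring′ = solve-∀

theorem4p3 : ∀ {m} (G : Graph (suc m)) (v w : Fin (suc m)) →
    Dist G v w 2 →
    ¬ Path3 G v w →
    (∀ z a b → (Adj G v a × ¬ Adj G w a) → (Adj G w b × ¬ Adj G v b) →
       ¬ (Adj G a z × Adj G b z)) →
    ∀ k → IndepH1 (vid G v w) k → IndepH1 G k
theorem4p3 G v w (step v~u₀ (step u₀~w here) , shortest) _ _ =
  IndepH1-reflect collapse collapse-face (cycle-preimage v~u₀ (Graph.sym G u₀~w))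
  where
  v≢w : v ≢ w
  v≢w v≡w = shortest 0 (s≤s z≤n) (subst (Walk G 0 v) v≡w here)
  v≁w : ¬ Adj G v w
  v≁w v~w = shortest 1 (s≤s (s≤s z≤n)) (step v~w here)
  open Identification G v≢w v≁w
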